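{- Let $p$ be a prime and let $P_p=\sum_{k=0}^{p-2}a_kp^k$ with digits $a_k\in\{0,1,\dots,p-1\}$ (so $P_p<p^{p-1}$) be a positive period (not necessarily minimal) of the sequence of Bell numbers modulo $p$, i.e. $B_{n+P_p}\equiv B_n\pmod p$ for all $n\geq 0$. Then $\sum_{k=0}^{p-2}a_k\geq p+1$.
   Context: $B_n$ denotes the $n$-th Bell number, the number of partitions of an $n$-element set into non-empty blocks. -}

module Defs where

open import Data.Nat using (ℕ; zero; suc; _+_; _*_; _^_)
open import Data.Nat.Combinatorics using (_C_)
open import Data.List using (List; []; _∷_; reverse; zipWith; upTo; map)
open import Data.Nat.ListAction using (sum)
open import Data.Fin using (Fin; zero; suc; toℕ)

-- bellsRev n = [B_n, B_{n-1}, ..., B_0]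
-- via B_0 = 1,  B_{m+1} = Σ_{k=0}^{m} (m choose k) B_k
bellsRev : ℕ → List ℕ
bellsRev zero = 1 ∷ []
bellsRev (suc m) with bellsRev m
... | bs = sum (zipWith _*_ (map (m C_) (upTo (suc m))) (reverse bs)) ∷ bs

B : ℕ → ℕ
B n with bellsRev n
... | []    = 0
... | b ∷ _ = b

Σ[<] : (n : ℕ) → (Fin n → ℕ) → ℕ
Σ[<] zero    f = 0
Σ[<] (suc n) f = f zero + Σ[<] n (λ i → f (suc i))

digitValue : (p m : ℕ) → (Fin m → ℕ) → ℕ
digitValue p m a = Σ[<] m (λ k → a k * p ^ toℕ k)

-- Let T g n = Σₖ C(n,k) g k, so that B (n+1) = T B n.  A coefficient vector V = c₀ … c_d
-- acts on sequences by ⟦ V ⟧ f n = Σᵢ cᵢ f (n+i), and V annihilates B mod p when ⟦ V ⟧ B ≡ 0.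
-- Since T is invertible and raising the index of B turns V(x) into V(x+1), annihilators are
-- closed under the forward difference, which lowers the degree and multiplies the leading
-- coefficient by the degree; hence every annihilator of degree < p vanishes mod p.
-- The defect uₙ = B (n+p) − B (n+1) − Bₙ obeys the Bell recurrence mod p, so x^p − x − 1 − u₀
-- annihilates B, and so does x(x−1)⋯(x−p+1) − 1 because T^p ≡ id mod p.  Their difference has
-- degree < p and constant term u₀, giving Touchard's congruence B (n+p) ≡ B (n+1) + Bₙ; iterated,
-- it gives B (n + a pᵏ) ≡ ⟦ (x+k)^a ⟧ B n.  A period P = Σ aₖ pᵏ therefore makes Q − 1 an
-- annihilator, for the monic Q = Πₖ (x+k)^aₖ of degree Σ aₖ ≥ 1.  If Σ aₖ < p this contradicts
-- the vanishing of annihilators; if Σ aₖ = p, then Q − 1 − (x^p − x − 1) vanishes mod p, so p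
-- divides Q(1) = Πₖ (k+1)^aₖ, which is impossible since k + 1 < p.

module Submission where

open import Defs
open import Data.Nat using (ℕ; zero; suc; _∸_; _<_; _≤_; _%_; NonZero; z≤n; s≤s)
import Data.Nat as ℕ
import Data.Nat.Properties as ℕₚ
open import Data.Nat.Combinatorics using (_C_; nC1≡n; nCk+nC[k+1]≡[n+1]C[k+1])
open import Data.Nat.Primality using (Prime; ¬prime[0]; ¬prime[1])
open import Data.Empty using (⊥-elim)
open import Data.Nat.ListAction using (sum)
import Data.List as List
open import Data.List.Properties using (reverse-applyDownFrom)
open import Data.Fin using (Fin)
import Data.Fin as Fin
open import Function using (_∘_)
open import Relation.Binary.PropositionalEquality using (_≡_; refl; sym; trans; cong; cong₂; module ≡-Reasoning)

module Binomial where
  open import Data.Nat.Divisibility using (_∣_; divides; ∣⇒≤)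
  open import Data.Nat.Primality using (euclidsLemma)
  open import Data.Sum using (inj₁; inj₂)
  open import Relation.Nullary using (contradiction)
  open import Data.Nat.Tactic.RingSolver using (solve-∀)
  open import Data.Nat using (_+_; _*_)

  [1+k]*[1+n]C[1+k]≡[1+n]*nCk : ∀ n k → suc k * (suc n C suc k) ≡ suc n * (n C k)
  [1+k]*[1+n]C[1+k]≡[1+n]*nCk n zero =
    trans (ℕₚ.*-identityˡ _) (trans (nC1≡n (suc n)) (sym (ℕₚ.*-identityʳ (suc n))))
  [1+k]*[1+n]C[1+k]≡[1+n]*nCk zero (suc k) = ℕₚ.*-zeroʳ (suc (suc k))
  [1+k]*[1+n]C[1+k]≡[1+n]*nCk (suc n) (suc k) = begin
    suc (suc k) * (suc (suc n) C suc (suc k))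
      ≡⟨ cong (suc (suc k) *_) (nCk+nC[k+1]≡[n+1]C[k+1] (suc n) (suc k)) ⟨
    suc (suc k) * (c + d)
      ≡⟨ split k c d ⟩
    c + (suc k * c + suc (suc k) * d)
      ≡⟨ cong₂ (λ x y → c + (x + y)) ([1+k]*[1+n]C[1+k]≡[1+n]*nCk n k) ([1+k]*[1+n]C[1+k]≡[1+n]*nCk n (suc k)) ⟩
    c + (suc n * (n C k) + suc n * (n C suc k))
      ≡⟨ cong (c +_) (ℕₚ.*-distribˡ-+ (suc n) (n C k) (n C suc k)) ⟨
    c + suc n * (n C k + n C suc k)
      ≡⟨ cong (λ x → c + suc n * x) (nCk+nC[k+1]≡[n+1]C[k+1] n k) ⟩
    suc (suc n) * c ∎
    where
      open ≡-Reasoning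
      c = suc n C suc k
      d = suc n C suc (suc k)
      split : ∀ k c d → suc (suc k) * (c + d) ≡ c + (suc k * c + suc (suc k) * d)
      split = solve-∀

  prime∣pCk : ∀ {n k} → Prime (suc n) → suc k < suc n → suc n ∣ suc n C suc k
  prime∣pCk {n} {k} p-prime k<p
    with euclidsLemma (suc k) _ p-prime (divides (n C k) (trans ([1+k]*[1+n]C[1+k]≡[1+n]*nCk n k) (ℕₚ.*-comm (suc n) (n C k))))
  ... | inj₁ p∣k = contradiction (∣⇒≤ p∣k) (ℕₚ.<⇒≱ k<p)
  ... | inj₂ p∣C = p∣C

module Sequences where
  open import Data.Integer using (ℤ; +_; -_; _+_; _*_; _-_)
  import Data.Integer.Properties as ℤₚ
  open import Data.Integer.Tactic.RingSolver using (solve-∀)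
  open import Data.Vec using (Vec; []; _∷_; zipWith; replicate; head)

  Seq : Set
  Seq = ℕ → ℤ

  1+m*x≡x+m*x : ∀ m x → + suc m * x ≡ x + + m * x
  1+m*x≡x+m*x m x = distrib (+ m) x
    where distrib : ∀ y x → (+ 1 + y) * x ≡ x + y * x
          distrib = solve-∀

  ∑ : ℕ → Seq → ℤ
  ∑ zero    f = + 0
  ∑ (suc n) f = f 0 + ∑ n (f ∘ suc)

  ∑-cong : ∀ n {f g : Seq} → (∀ k → f k ≡ g k) → ∑ n f ≡ ∑ n g
  ∑-cong zero    f≗g = refl
  ∑-cong (suc n) f≗g = cong₂ _+_ (f≗g 0) (∑-cong n (f≗g ∘ suc))

  ∑-0 : ∀ n → ∑ n (λ _ → + 0) ≡ + 0
  ∑-0 zero    = refl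
  ∑-0 (suc n) = trans (ℤₚ.+-identityˡ _) (∑-0 n)

  ∑-+ : ∀ n (f g : Seq) → ∑ n (λ k → f k + g k) ≡ ∑ n f + ∑ n g
  ∑-+ zero    f g = refl
  ∑-+ (suc n) f g = trans (cong (_+_ (f 0 + g 0)) (∑-+ n (f ∘ suc) (g ∘ suc))) (swap (f 0) (g 0) _ _)
    where swap : ∀ a b c d → a + b + (c + d) ≡ a + c + (b + d)
          swap = solve-∀

  ∑-init-last : ∀ n (f : Seq) → ∑ (suc n) f ≡ ∑ n f + f n
  ∑-init-last zero    f = ℤₚ.+-comm (f 0) (+ 0)
  ∑-init-last (suc n) f = trans (cong (_+_ (f 0)) (∑-init-last n (f ∘ suc))) (sym (ℤₚ.+-assoc (f 0) _ _))

  +sum-zipWith-* : ∀ n (g h : ℕ → ℕ) (f : ℕ → ℕ) →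
    + sum (List.zipWith ℕ._*_ (List.map g (List.applyUpTo f n)) (List.applyUpTo h n)) ≡ ∑ n (λ k → + g (f k) * + h k)
  +sum-zipWith-* zero    g h f = refl
  +sum-zipWith-* (suc n) g h f = begin
    + (g (f 0) ℕ.* h 0 ℕ.+ rest)                 ≡⟨ ℤₚ.pos-+ _ rest ⟩
    + (g (f 0) ℕ.* h 0) + + rest                 ≡⟨ cong₂ _+_ (ℤₚ.pos-* (g (f 0)) (h 0)) (+sum-zipWith-* n g (h ∘ suc) (f ∘ suc)) ⟩
    + g (f 0) * + h 0 + ∑ n (λ k → + g (f (suc k)) * + h (suc k)) ∎
    where
      open ≡-Reasoning
      rest = sum (List.zipWith ℕ._*_ (List.map g (List.applyUpTo (f ∘ suc) n)) (List.applyUpTo (h ∘ suc) n))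

  T : Seq → Seq
  T g zero    = g 0
  T g (suc n) = T g n + T (g ∘ suc) n

  T-cong : ∀ {g h : Seq} → (∀ k → g k ≡ h k) → ∀ n → T g n ≡ T h n
  T-cong g≗h zero    = g≗h 0
  T-cong g≗h (suc n) = cong₂ _+_ (T-cong g≗h n) (T-cong (g≗h ∘ suc) n)

  T-+ : ∀ (g h : Seq) n → T (λ k → g k + h k) n ≡ T g n + T h n
  T-+ g h zero    = refl
  T-+ g h (suc n) = trans (cong₂ _+_ (T-+ g h n) (T-+ (g ∘ suc) (h ∘ suc) n))
                        (swap (T g n) (T h n) (T (g ∘ suc) n) (T (h ∘ suc) n))
    where swap : ∀ a b c d → a + b + (c + d) ≡ a + c + (b + d)
          swap = solve-∀

  T-* : ∀ c (g : Seq) n → T (λ k → c * g k) n ≡ c * T g n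
  T-* c g zero    = refl
  T-* c g (suc n) = trans (cong₂ _+_ (T-* c g n) (T-* c (g ∘ suc) n)) (sym (ℤₚ.*-distribˡ-+ c _ _))

  T-- : ∀ (g h : Seq) n → T (λ k → g k - h k) n ≡ T g n - T h n
  T-- g h zero    = refl
  T-- g h (suc n) = trans (cong₂ _+_ (T-- g h n) (T-- (g ∘ suc) (h ∘ suc) n))
                          (regroup (T g n) (T h n) (T (g ∘ suc) n) (T (h ∘ suc) n))
    where regroup : ∀ a b c d → a - b + (c - d) ≡ a + c - (b + d)
          regroup = solve-∀

  T-suc : ∀ (g : Seq) n → T g (suc n) ≡ T (λ k → g (suc k) + g k) n
  T-suc g n = trans (ℤₚ.+-comm (T g n) _) (sym (T-+ (g ∘ suc) g n))

  T-∑ : ∀ m N (g : Seq) → m < N → ∑ N (λ k → + (m C k) * g k) ≡ T g m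
  T-∑ zero (suc N) g _ = begin
    + 1 * g 0 + ∑ N (λ _ → + 0)   ≡⟨ cong (_+_ (+ 1 * g 0)) (∑-0 N) ⟩
    + 1 * g 0 + + 0               ≡⟨ unit (g 0) ⟩
    g 0                           ∎
    where
      open ≡-Reasoning
      unit : ∀ a → + 1 * a + + 0 ≡ a
      unit = solve-∀
  T-∑ (suc m) (suc N) g (s≤s m<N) = begin
    + 1 * g 0 + ∑ N (λ k → + (suc m C suc k) * g (suc k))
      ≡⟨ cong (_+_ (+ 1 * g 0)) (trans (∑-cong N pascal) (∑-+ N _ _)) ⟩
    + 1 * g 0 + (∑ N (λ k → + (m C k) * g (suc k)) + ∑ N (λ k → + (m C suc k) * g (suc k)))
      ≡⟨ swap (+ 1 * g 0) _ _ ⟩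
    ∑ (suc N) (λ k → + (m C k) * g k) + ∑ N (λ k → + (m C k) * g (suc k))
      ≡⟨ cong₂ _+_ (T-∑ m (suc N) g (ℕₚ.m<n⇒m<1+n m<N)) (T-∑ m N (g ∘ suc) m<N) ⟩
    T g m + T (g ∘ suc) m ∎
    where
      open ≡-Reasoning
      swap : ∀ a b c → a + (b + c) ≡ (a + c) + b
      swap = solve-∀
      pascal : ∀ k → + (suc m C suc k) * g (suc k) ≡ + (m C k) * g (suc k) + + (m C suc k) * g (suc k)
      pascal k = begin
        + (suc m C suc k) * g (suc k)              ≡⟨ cong (λ c → + c * g (suc k)) (nCk+nC[k+1]≡[n+1]C[k+1] m k) ⟨
        + (m C k ℕ.+ m C suc k) * g (suc k)         ≡⟨ cong (_* g (suc k)) (ℤₚ.pos-+ (m C k) (m C suc k)) ⟩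
        (+ (m C k) + + (m C suc k)) * g (suc k)    ≡⟨ ℤₚ.*-distribʳ-+ (g (suc k)) (+ (m C k)) (+ (m C suc k)) ⟩
        + (m C k) * g (suc k) + + (m C suc k) * g (suc k) ∎

  T-vandermonde : ∀ m (g : Seq) n → T g (n ℕ.+ m) ≡ T (λ k → T (λ j → g (k ℕ.+ j)) m) n
  T-vandermonde zero    g n = trans (cong (T g) (ℕₚ.+-identityʳ n)) (T-cong (λ k → cong g (sym (ℕₚ.+-identityʳ k))) n)
  T-vandermonde (suc m) g n = begin
    T g (n ℕ.+ suc m)                                                  ≡⟨ trans (cong (T g) (ℕₚ.+-suc n m)) (T-suc g (n ℕ.+ m)) ⟩
    T (λ k → g (suc k) + g k) (n ℕ.+ m)                                ≡⟨ T-vandermonde m (λ k → g (suc k) + g k) n ⟩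
    T (λ k → T (λ j → g (suc (k ℕ.+ j)) + g (k ℕ.+ j)) m) n           ≡⟨ T-cong inner n ⟩
    T (λ k → T (λ j → g (k ℕ.+ j)) (suc m)) n                          ∎
    where
      open ≡-Reasoning
      inner : ∀ k → T (λ j → g (suc (k ℕ.+ j)) + g (k ℕ.+ j)) m ≡ T (λ j → g (k ℕ.+ j)) (suc m)
      inner k = trans (T-cong (λ j → cong (λ i → g i + g (k ℕ.+ j)) (sym (ℕₚ.+-suc k j))) m)
                      (sym (T-suc (λ j → g (k ℕ.+ j)) m))

  BellLike : Seq → Set
  BellLike f = ∀ n → f (suc n) ≡ T f n

  𝐁 : Seq
  𝐁 n = + B n

  bellsRev≡applyDownFrom : ∀ n → bellsRev n ≡ List.applyDownFrom B (suc n)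
  bellsRev≡applyDownFrom zero    = refl
  bellsRev≡applyDownFrom (suc n) = cong (B (suc n) List.∷_) (bellsRev≡applyDownFrom n)

  𝐁-suc : BellLike 𝐁
  𝐁-suc n = begin
    weighted (List.reverse (bellsRev n))                    ≡⟨ cong (weighted ∘ List.reverse) (bellsRev≡applyDownFrom n) ⟩
    weighted (List.reverse (List.applyDownFrom B (suc n)))  ≡⟨ cong weighted (reverse-applyDownFrom B (suc n)) ⟩
    weighted (List.applyUpTo B (suc n))                     ≡⟨ +sum-zipWith-* (suc n) (n C_) B (λ k → k) ⟩
    ∑ (suc n) (λ k → + (n C k) * 𝐁 k)                       ≡⟨ T-∑ n (suc n) 𝐁 ℕₚ.≤-refl ⟩
    T 𝐁 n                                                   ∎
    where
      open ≡-Reasoning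
      weighted : List.List ℕ → ℤ
      weighted bs = + sum (List.zipWith ℕ._*_ (List.map (n C_) (List.upTo (suc n))) bs)

  infixl 6 _⊕_ _⊖_

  _⊕_ : ∀ {k} → Vec ℤ k → Vec ℤ k → Vec ℤ k
  _⊕_ = zipWith _+_

  _⊖_ : ∀ {k} → Vec ℤ k → Vec ℤ k → Vec ℤ k
  _⊖_ = zipWith _-_

  -- Coefficient vectors list the constant term first; x acts as the index shift.
  ⟦_⟧ : ∀ {k} → Vec ℤ k → Seq → Seq
  ⟦ []     ⟧ f n = + 0
  ⟦ c ∷ cs ⟧ f n = c * f n + ⟦ cs ⟧ f (suc n)

  ⟦⟧-cong : ∀ {k} (V : Vec ℤ k) {f g : Seq} → (∀ j → f j ≡ g j) → ∀ n → ⟦ V ⟧ f n ≡ ⟦ V ⟧ g n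
  ⟦⟧-cong []       f≗g n = refl
  ⟦⟧-cong (c ∷ cs) f≗g n = cong₂ _+_ (cong (c *_) (f≗g n)) (⟦⟧-cong cs f≗g (suc n))

  ⟦⟧-+ : ∀ {k} (V : Vec ℤ k) (f g : Seq) n → ⟦ V ⟧ (λ j → f j + g j) n ≡ ⟦ V ⟧ f n + ⟦ V ⟧ g n
  ⟦⟧-+ []       f g n = refl
  ⟦⟧-+ (c ∷ cs) f g n = trans (cong (_+_ (c * (f n + g n))) (⟦⟧-+ cs f g (suc n))) (distrib c (f n) (g n) _ _)
    where distrib : ∀ c a b x y → c * (a + b) + (x + y) ≡ (c * a + x) + (c * b + y)
          distrib = solve-∀

  ⟦⟧-shift : ∀ {k} (V : Vec ℤ k) (f : Seq) m n → ⟦ V ⟧ (λ j → f (j ℕ.+ m)) n ≡ ⟦ V ⟧ f (n ℕ.+ m)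
  ⟦⟧-shift []       f m n = refl
  ⟦⟧-shift (c ∷ cs) f m n = cong (_+_ (c * f (n ℕ.+ m))) (⟦⟧-shift cs f m (suc n))

  ⟦⟧-⊕ : ∀ {k} (V W : Vec ℤ k) (f : Seq) n → ⟦ V ⊕ W ⟧ f n ≡ ⟦ V ⟧ f n + ⟦ W ⟧ f n
  ⟦⟧-⊕ []       []       f n = refl
  ⟦⟧-⊕ (c ∷ cs) (d ∷ ds) f n = trans (cong (_+_ ((c + d) * f n)) (⟦⟧-⊕ cs ds f (suc n))) (distrib c d (f n) _ _)
    where distrib : ∀ c d a x y → (c + d) * a + (x + y) ≡ (c * a + x) + (d * a + y)
          distrib = solve-∀

  ⟦⟧-⊖ : ∀ {k} (V W : Vec ℤ k) (f : Seq) n → ⟦ V ⊖ W ⟧ f n ≡ ⟦ V ⟧ f n - ⟦ W ⟧ f n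
  ⟦⟧-⊖ []       []       f n = refl
  ⟦⟧-⊖ (c ∷ cs) (d ∷ ds) f n = trans (cong (_+_ ((c - d) * f n)) (⟦⟧-⊖ cs ds f (suc n))) (distrib c d (f n) _ _)
    where distrib : ∀ c d a x y → (c - d) * a + (x - y) ≡ (c * a + x) - (d * a + y)
          distrib = solve-∀

  lead : ∀ {k} → Vec ℤ (suc k) → ℤ
  lead (c ∷ [])         = c
  lead (c ∷ cs@(_ ∷ _)) = lead cs

  init : ∀ {k} → Vec ℤ (suc k) → Vec ℤ k
  init (c ∷ [])         = []
  init (c ∷ cs@(_ ∷ _)) = c ∷ init cs

  lead-∷ : ∀ {k} c (V : Vec ℤ (suc k)) → lead (c ∷ V) ≡ lead V
  lead-∷ c (_ ∷ _) = refl

  lead-⊕ : ∀ {k} (V W : Vec ℤ (suc k)) → lead (V ⊕ W) ≡ lead V + lead W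
  lead-⊕ (c ∷ [])         (d ∷ [])         = refl
  lead-⊕ (c ∷ cs@(_ ∷ _)) (d ∷ ds@(_ ∷ _)) = lead-⊕ cs ds

  lead-⊖ : ∀ {k} (V W : Vec ℤ (suc k)) → lead (V ⊖ W) ≡ lead V - lead W
  lead-⊖ (c ∷ [])         (d ∷ [])         = refl
  lead-⊖ (c ∷ cs@(_ ∷ _)) (d ∷ ds@(_ ∷ _)) = lead-⊖ cs ds

  head-⊖ : ∀ {k} (V W : Vec ℤ (suc k)) → head (V ⊖ W) ≡ head V - head W
  head-⊖ (_ ∷ _) (_ ∷ _) = refl

  ⟦⟧-init : ∀ {k} (V : Vec ℤ (suc k)) (f : Seq) n → ⟦ V ⟧ f n ≡ ⟦ init V ⟧ f n + lead V * f (n ℕ.+ k)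
  ⟦⟧-init (c ∷ []) f n = begin
    c * f n + + 0         ≡⟨ ℤₚ.+-identityʳ _ ⟩
    c * f n               ≡⟨ cong (λ i → c * f i) (ℕₚ.+-identityʳ n) ⟨
    c * f (n ℕ.+ 0)       ≡⟨ ℤₚ.+-identityˡ _ ⟨
    + 0 + c * f (n ℕ.+ 0) ∎
    where open ≡-Reasoning
  ⟦⟧-init {suc k} (c ∷ cs@(_ ∷ _)) f n = begin
    c * f n + ⟦ cs ⟧ f (suc n)
      ≡⟨ cong (_+_ (c * f n)) (⟦⟧-init cs f (suc n)) ⟩
    c * f n + (⟦ init cs ⟧ f (suc n) + lead cs * f (suc n ℕ.+ k))
      ≡⟨ ℤₚ.+-assoc (c * f n) _ _ ⟨
    c * f n + ⟦ init cs ⟧ f (suc n) + lead cs * f (suc n ℕ.+ k)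
      ≡⟨ cong (λ i → c * f n + ⟦ init cs ⟧ f (suc n) + lead cs * f i) (ℕₚ.+-suc n k) ⟨
    c * f n + ⟦ init cs ⟧ f (suc n) + lead cs * f (n ℕ.+ suc k) ∎
    where open ≡-Reasoning

  at1 : ∀ {k} → Vec ℤ k → ℤ
  at1 []       = + 0
  at1 (c ∷ cs) = c + at1 cs

  at1-⊖ : ∀ {k} (V W : Vec ℤ k) → at1 (V ⊖ W) ≡ at1 V - at1 W
  at1-⊖ []       []       = refl
  at1-⊖ (c ∷ cs) (d ∷ ds) = trans (cong (_+_ (c - d)) (at1-⊖ cs ds)) (regroup c d _ _)
    where regroup : ∀ a b c d → a - b + (c - d) ≡ (a + c) - (b + d)
          regroup = solve-∀

  const : ∀ k → ℤ → Vec ℤ (suc k)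
  const k c = c ∷ replicate k (+ 0)

  ⟦⟧-const : ∀ k c (f : Seq) n → ⟦ const k c ⟧ f n ≡ c * f n
  ⟦⟧-const k c f n = trans (cong (_+_ (c * f n)) (zeros k (suc n))) (ℤₚ.+-identityʳ (c * f n))
    where zeros : ∀ k n → ⟦ replicate k (+ 0) ⟧ f n ≡ + 0
          zeros zero    n = refl
          zeros (suc k) n = trans (ℤₚ.+-identityˡ _) (zeros k (suc n))

  lead-const : ∀ k c → lead (const (suc k) c) ≡ + 0
  lead-const k c = zeros k
    where zeros : ∀ k → lead (replicate (suc k) (+ 0)) ≡ + 0
          zeros zero    = refl
          zeros (suc k) = zeros k

  at1-const : ∀ k c → at1 (const k c) ≡ c
  at1-const k c = trans (cong (_+_ c) (zeros k)) (ℤₚ.+-identityʳ c)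
    where zeros : ∀ k → at1 (replicate k (+ 0)) ≡ + 0
          zeros zero    = refl
          zeros (suc k) = trans (ℤₚ.+-identityˡ _) (zeros k)

  X^ : ∀ k → Vec ℤ (suc k)
  X^ zero    = + 1 ∷ []
  X^ (suc k) = + 0 ∷ X^ k

  ⟦⟧-X^ : ∀ k (f : Seq) n → ⟦ X^ k ⟧ f n ≡ f (n ℕ.+ k)
  ⟦⟧-X^ zero    f n = trans (ℤₚ.+-identityʳ _) (trans (ℤₚ.*-identityˡ (f n)) (cong f (sym (ℕₚ.+-identityʳ n))))
  ⟦⟧-X^ (suc k) f n = trans (ℤₚ.+-identityˡ _) (trans (⟦⟧-X^ k f (suc n)) (cong f (sym (ℕₚ.+-suc n k))))

  lead-X^ : ∀ k → lead (X^ k) ≡ + 1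
  lead-X^ zero    = refl
  lead-X^ (suc k) = trans (lead-∷ (+ 0) (X^ k)) (lead-X^ k)

  at1-X^ : ∀ k → at1 (X^ k) ≡ + 1
  at1-X^ zero    = refl
  at1-X^ (suc k) = trans (ℤₚ.+-identityˡ _) (at1-X^ k)

  module _ (k : ℕ) where
    private
      x^[2+k] x one : Vec ℤ (3 ℕ.+ k)
      x^[2+k] = X^ (2 ℕ.+ k)
      x       = + 0 ∷ const (suc k) (+ 1)
      one     = const (2 ℕ.+ k) (+ 1)

    x^[2+k]-x-1 : Vec ℤ (3 ℕ.+ k)
    x^[2+k]-x-1 = x^[2+k] ⊖ x ⊖ one

    ⟦⟧-x^[2+k]-x-1 : ∀ (f : Seq) n → ⟦ x^[2+k]-x-1 ⟧ f n ≡ f (n ℕ.+ (2 ℕ.+ k)) - f (suc n) - f n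
    ⟦⟧-x^[2+k]-x-1 f n = begin
      ⟦ x^[2+k] ⊖ x ⊖ one ⟧ f n                                    ≡⟨ ⟦⟧-⊖ (x^[2+k] ⊖ x) one f n ⟩
      ⟦ x^[2+k] ⊖ x ⟧ f n - ⟦ one ⟧ f n                           ≡⟨ cong₂ _-_ (⟦⟧-⊖ x^[2+k] x f n) (⟦⟧-const (2 ℕ.+ k) (+ 1) f n) ⟩
      ⟦ x^[2+k] ⟧ f n - (+ 0 * f n + ⟦ const (suc k) (+ 1) ⟧ f (suc n)) - + 1 * f n
        ≡⟨ cong₂ (λ a b → a - (+ 0 * f n + b) - + 1 * f n) (⟦⟧-X^ (2 ℕ.+ k) f n) (⟦⟧-const (suc k) (+ 1) f (suc n)) ⟩
      f (n ℕ.+ (2 ℕ.+ k)) - (+ 0 * f n + + 1 * f (suc n)) - + 1 * f n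
        ≡⟨ simplify (f (n ℕ.+ (2 ℕ.+ k))) (f (suc n)) (f n) ⟩
      f (n ℕ.+ (2 ℕ.+ k)) - f (suc n) - f n                       ∎
      where
        open ≡-Reasoning
        simplify : ∀ a b c → a - (+ 0 * c + + 1 * b) - + 1 * c ≡ a - b - c
        simplify = solve-∀

    lead-x^[2+k]-x-1 : lead x^[2+k]-x-1 ≡ + 1
    lead-x^[2+k]-x-1 = begin
      lead (x^[2+k] ⊖ x ⊖ one)                ≡⟨ lead-⊖ (x^[2+k] ⊖ x) one ⟩
      lead (x^[2+k] ⊖ x) - lead one           ≡⟨ cong₂ _-_ (lead-⊖ x^[2+k] x) (lead-const (suc k) (+ 1)) ⟩
      lead x^[2+k] - lead x - + 0             ≡⟨ cong₂ (λ a b → a - b - + 0) (lead-X^ (2 ℕ.+ k)) (trans (lead-∷ (+ 0) (const (suc k) (+ 1))) (lead-const k (+ 1))) ⟩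
      + 1 - + 0 - + 0                         ∎
      where open ≡-Reasoning

    at1-x^[2+k]-x-1 : at1 x^[2+k]-x-1 ≡ - + 1
    at1-x^[2+k]-x-1 = begin
      at1 (x^[2+k] ⊖ x ⊖ one)                 ≡⟨ at1-⊖ (x^[2+k] ⊖ x) one ⟩
      at1 (x^[2+k] ⊖ x) - at1 one             ≡⟨ cong₂ _-_ (at1-⊖ x^[2+k] x) (at1-const (2 ℕ.+ k) (+ 1)) ⟩
      at1 x^[2+k] - (+ 0 + at1 (const (suc k) (+ 1))) - + 1
        ≡⟨ cong₂ (λ a b → a - (+ 0 + b) - + 1) (at1-X^ (2 ℕ.+ k)) (at1-const (suc k) (+ 1)) ⟩
      + 1 - (+ 0 + + 1) - + 1                 ∎
      where open ≡-Reasoning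

  addHead : ∀ {k} → ℤ → Vec ℤ (suc k) → Vec ℤ (suc k)
  addHead a (w ∷ ws) = a + w ∷ ws

  mul-x+ : ∀ {k} → ℤ → Vec ℤ k → Vec ℤ (suc k)
  mul-x+ c []       = + 0 ∷ []
  mul-x+ c (v ∷ vs) = c * v ∷ addHead v (mul-x+ c vs)

  ⟦⟧-mul-x+ : ∀ {k} c (V : Vec ℤ k) (f : Seq) n → ⟦ mul-x+ c V ⟧ f n ≡ ⟦ V ⟧ f (suc n) + c * ⟦ V ⟧ f n
  ⟦⟧-mul-x+ c []       f n = vanish c (f n)
    where vanish : ∀ c a → + 0 * a + + 0 ≡ + 0 + c * + 0
          vanish = solve-∀
  ⟦⟧-mul-x+ c (v ∷ vs) f n = begin
    c * v * f n + ⟦ addHead v (mul-x+ c vs) ⟧ f (suc n)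
      ≡⟨ cong (_+_ (c * v * f n)) (⟦⟧-addHead v (mul-x+ c vs) (suc n)) ⟩
    c * v * f n + (v * f (suc n) + ⟦ mul-x+ c vs ⟧ f (suc n))
      ≡⟨ cong (λ x → c * v * f n + (v * f (suc n) + x)) (⟦⟧-mul-x+ c vs f (suc n)) ⟩
    c * v * f n + (v * f (suc n) + (⟦ vs ⟧ f (2 ℕ.+ n) + c * ⟦ vs ⟧ f (suc n)))
      ≡⟨ regroup c v (f n) (f (suc n)) _ _ ⟩
    v * f (suc n) + ⟦ vs ⟧ f (2 ℕ.+ n) + c * (v * f n + ⟦ vs ⟧ f (suc n)) ∎
    where
      open ≡-Reasoning
      ⟦⟧-addHead : ∀ {k} a (W : Vec ℤ (suc k)) n → ⟦ addHead a W ⟧ f n ≡ a * f n + ⟦ W ⟧ f n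
      ⟦⟧-addHead a (w ∷ ws) n = trans (cong (_+ ⟦ ws ⟧ f (suc n)) (ℤₚ.*-distribʳ-+ (f n) a w)) (ℤₚ.+-assoc (a * f n) _ _)
      regroup : ∀ c v a b x y → c * v * a + (v * b + (x + c * y)) ≡ v * b + x + c * (v * a + y)
      regroup = solve-∀

  lead-mul-x+ : ∀ {k} c (V : Vec ℤ (suc k)) → lead (mul-x+ c V) ≡ lead V
  lead-mul-x+ c (v ∷ [])           = ℤₚ.+-identityʳ v
  lead-mul-x+ c (v ∷ vs@(w ∷ ws)) = begin
    lead (addHead v (c * w ∷ addHead w (mul-x+ c ws)))  ≡⟨ lead-∷ (v + c * w) (addHead w (mul-x+ c ws)) ⟩
    lead (addHead w (mul-x+ c ws))                     ≡⟨ lead-∷ (c * w) (addHead w (mul-x+ c ws)) ⟨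
    lead (mul-x+ c vs)                                 ≡⟨ lead-mul-x+ c vs ⟩
    lead vs                                            ∎
    where open ≡-Reasoning

  at1-mul-x+ : ∀ {k} c (V : Vec ℤ k) → at1 (mul-x+ c V) ≡ (+ 1 + c) * at1 V
  at1-mul-x+ c []       = sym (ℤₚ.*-zeroʳ (+ 1 + c))
  at1-mul-x+ c (v ∷ vs) = begin
    c * v + at1 (addHead v (mul-x+ c vs))  ≡⟨ cong (_+_ (c * v)) (at1-addHead v (mul-x+ c vs)) ⟩
    c * v + (v + at1 (mul-x+ c vs))        ≡⟨ cong (λ x → c * v + (v + x)) (at1-mul-x+ c vs) ⟩
    c * v + (v + (+ 1 + c) * at1 vs)       ≡⟨ regroup c v (at1 vs) ⟩
    (+ 1 + c) * (v + at1 vs)               ∎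
    where
      open ≡-Reasoning
      at1-addHead : ∀ {k} a (W : Vec ℤ (suc k)) → at1 (addHead a W) ≡ a + at1 W
      at1-addHead a (w ∷ ws) = ℤₚ.+-assoc a w (at1 ws)
      regroup : ∀ c v s → c * v + (v + (+ 1 + c) * s) ≡ (+ 1 + c) * (v + s)
      regroup = solve-∀

  -- Δ V = V(x+1) − V(x): for V = c + x·V′ it equals V′ + (x+1)·Δ V′.
  Δ : ∀ {k} → Vec ℤ (suc k) → Vec ℤ k
  Δ (c ∷ [])         = []
  Δ (c ∷ cs@(_ ∷ _)) = cs ⊕ mul-x+ (+ 1) (Δ cs)

  lead-Δ : ∀ {k} (V : Vec ℤ (2 ℕ.+ k)) → lead (Δ V) ≡ + suc k * lead V
  lead-Δ (c ∷ d ∷ []) = unit d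
    where unit : ∀ d → d + + 0 ≡ + 1 * d
          unit = solve-∀
  lead-Δ {suc k} (c ∷ cs@(_ ∷ _ ∷ _)) = begin
    lead (cs ⊕ mul-x+ (+ 1) (Δ cs))       ≡⟨ lead-⊕ cs (mul-x+ (+ 1) (Δ cs)) ⟩
    lead cs + lead (mul-x+ (+ 1) (Δ cs))  ≡⟨ cong (_+_ (lead cs)) (trans (lead-mul-x+ (+ 1) (Δ cs)) (lead-Δ cs)) ⟩
    lead cs + + suc k * lead cs           ≡⟨ 1+m*x≡x+m*x (suc k) (lead cs) ⟨
    + suc (suc k) * lead cs               ∎
    where open ≡-Reasoning

  -- Raising the index of a Bell-like sequence turns V(x) into V(x+1) = V + Δ V under T.
  ⟦⟧-suc : ∀ {f : Seq} → BellLike f → ∀ {k} (V : Vec ℤ (suc k)) n →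
           ⟦ V ⟧ f (suc n) ≡ T (λ j → ⟦ Δ V ⟧ f j + ⟦ V ⟧ f j) n
  ⟦⟧-suc {f} f-rec (c ∷ []) n = begin
    c * f (suc n) + + 0                 ≡⟨ trans (ℤₚ.+-identityʳ _) (cong (c *_) (f-rec n)) ⟩
    c * T f n                           ≡⟨ T-* c f n ⟨
    T (λ j → c * f j) n                 ≡⟨ T-cong (λ j → pad (c * f j)) n ⟩
    T (λ j → + 0 + (c * f j + + 0)) n   ∎
    where
      open ≡-Reasoning
      pad : ∀ a → a ≡ + 0 + (a + + 0)
      pad = solve-∀
  ⟦⟧-suc {f} f-rec (c ∷ cs@(_ ∷ _)) n = begin
    c * f (suc n) + ⟦ cs ⟧ f (2 ℕ.+ n)
      ≡⟨ cong₂ _+_ (trans (cong (c *_) (f-rec n)) (sym (T-* c f n)))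
                   (trans (⟦⟧-suc f-rec cs (suc n)) (T-suc h n)) ⟩
    T (λ j → c * f j) n + T (λ j → h (suc j) + h j) n
      ≡⟨ T-+ (λ j → c * f j) (λ j → h (suc j) + h j) n ⟨
    T (λ j → c * f j + (h (suc j) + h j)) n
      ≡⟨ T-cong expand n ⟩
    T (λ j → ⟦ Δ (c ∷ cs) ⟧ f j + ⟦ c ∷ cs ⟧ f j) n ∎
    where
      open ≡-Reasoning
      h : Seq
      h j = ⟦ Δ cs ⟧ f j + ⟦ cs ⟧ f j
      regroup : ∀ c a D₀ D₁ C₀ C₁ → c * a + ((D₁ + C₁) + (D₀ + C₀)) ≡ (C₀ + (D₁ + + 1 * D₀)) + (c * a + C₁)
      regroup = solve-∀
      expand : ∀ j → c * f j + (h (suc j) + h j) ≡ ⟦ Δ (c ∷ cs) ⟧ f j + ⟦ c ∷ cs ⟧ f j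
      expand j = trans (regroup c (f j) (⟦ Δ cs ⟧ f j) (⟦ Δ cs ⟧ f (suc j)) (⟦ cs ⟧ f j) (⟦ cs ⟧ f (suc j)))
        (cong (_+ (c * f j + ⟦ cs ⟧ f (suc j)))
          (sym (trans (⟦⟧-⊕ cs (mul-x+ (+ 1) (Δ cs)) f j) (cong (_+_ (⟦ cs ⟧ f j)) (⟦⟧-mul-x+ (+ 1) (Δ cs) f j)))))

  T^ : ℕ → Seq → Seq
  T^ zero    g = g
  T^ (suc m) g = T (T^ m g)

  T^-cong : ∀ m {g h : Seq} → (∀ k → g k ≡ h k) → ∀ n → T^ m g n ≡ T^ m h n
  T^-cong zero    g≗h n = g≗h n
  T^-cong (suc m) g≗h n = T-cong (T^-cong m g≗h) n

  T^-+ : ∀ m (g h : Seq) n → T^ m (λ k → g k + h k) n ≡ T^ m g n + T^ m h n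
  T^-+ zero    g h n = refl
  T^-+ (suc m) g h n = trans (T-cong (T^-+ m g h) n) (T-+ (T^ m g) (T^ m h) n)

  T^-* : ∀ m c (g : Seq) n → T^ m (λ k → c * g k) n ≡ c * T^ m g n
  T^-* zero    c g n = refl
  T^-* (suc m) c g n = trans (T-cong (T^-* m c g) n) (T-* c (T^ m g) n)

  T^-at-0 : ∀ m (g : Seq) → T^ m g 0 ≡ g 0
  T^-at-0 zero    g = refl
  T^-at-0 (suc m) g = T^-at-0 m g

  T^-T : ∀ m (g : Seq) n → T^ m (T g) n ≡ T (T^ m g) n
  T^-T zero    g n = refl
  T^-T (suc m) g n = T-cong (T^-T m g) n

  T^-suc : ∀ m (g : Seq) n → T^ m g (suc n) ≡ T^ m (λ k → g (suc k) + + m * g k) n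
  T^-suc zero    g n = sym (ℤₚ.+-identityʳ (g (suc n)))
  T^-suc (suc m) g n = begin
    T (T^ m g) (suc n)
      ≡⟨ T-suc (T^ m g) n ⟩
    T (λ k → T^ m g (suc k) + T^ m g k) n
      ≡⟨ T-cong (λ k → cong (_+ T^ m g k) (T^-suc m g k)) n ⟩
    T (λ k → T^ m (λ j → g (suc j) + + m * g j) k + T^ m g k) n
      ≡⟨ T-cong (λ k → sym (T^-+ m (λ j → g (suc j) + + m * g j) g k)) n ⟩
    T (T^ m (λ j → g (suc j) + + m * g j + g j)) n
      ≡⟨ T-cong (T^-cong m (λ j → regroup (g (suc j)) (g j))) n ⟩
    T (T^ m (λ j → g (suc j) + + suc m * g j)) n ∎
    where
      open ≡-Reasoning
      regroup : ∀ a b → a + + m * b + b ≡ a + + suc m * b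
      regroup a b = trans (ℤₚ.+-assoc a _ b) (cong (_+_ a) (trans (ℤₚ.+-comm _ b) (sym (1+m*x≡x+m*x m b))))

  T^-suc-bellLike : ∀ {f : Seq} → BellLike f → ∀ m n → T^ m f (suc n) ≡ T^ (suc m) f n + + m * T^ m f n
  T^-suc-bellLike {f} f-rec m n = begin
    T^ m f (suc n)                          ≡⟨ T^-suc m f n ⟩
    T^ m (λ k → f (suc k) + + m * f k) n    ≡⟨ T^-cong m (λ k → cong (_+ + m * f k) (f-rec k)) n ⟩
    T^ m (λ k → T f k + + m * f k) n        ≡⟨ T^-+ m (T f) (λ k → + m * f k) n ⟩
    T^ m (T f) n + T^ m (λ k → + m * f k) n ≡⟨ cong₂ _+_ (T^-T m f n) (T^-* m (+ m) f n) ⟩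
    T (T^ m f) n + + m * T^ m f n           ∎
    where open ≡-Reasoning

  falling : ∀ m → Vec ℤ (suc m)
  falling zero    = + 1 ∷ []
  falling (suc m) = mul-x+ (- + m) (falling m)

  ⟦⟧-falling : ∀ {f : Seq} → BellLike f → ∀ m n → ⟦ falling m ⟧ f n ≡ T^ m f n
  ⟦⟧-falling {f} f-rec zero    n = unit (f n)
    where unit : ∀ a → + 1 * a + + 0 ≡ a
          unit = solve-∀
  ⟦⟧-falling {f} f-rec (suc m) n = begin
    ⟦ mul-x+ (- + m) (falling m) ⟧ f n
      ≡⟨ ⟦⟧-mul-x+ (- + m) (falling m) f n ⟩
    ⟦ falling m ⟧ f (suc n) + - + m * ⟦ falling m ⟧ f n
      ≡⟨ cong₂ (λ a b → a + - + m * b) (⟦⟧-falling f-rec m (suc n)) (⟦⟧-falling f-rec m n) ⟩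
    T^ m f (suc n) + - + m * T^ m f n
      ≡⟨ cong (_+ - + m * T^ m f n) (T^-suc-bellLike f-rec m n) ⟩
    T^ (suc m) f n + + m * T^ m f n + - + m * T^ m f n
      ≡⟨ cancel (T^ (suc m) f n) (+ m) (T^ m f n) ⟩
    T^ (suc m) f n ∎
    where
      open ≡-Reasoning
      cancel : ∀ a y x → a + y * x + - y * x ≡ a
      cancel = solve-∀

  lead-falling : ∀ m → lead (falling m) ≡ + 1
  lead-falling zero    = refl
  lead-falling (suc m) = trans (lead-mul-x+ (- + m) (falling m)) (lead-falling m)

  head-falling : ∀ m → head (falling (suc m)) ≡ + 0
  head-falling zero    = refl
  head-falling (suc m) = begin
    head (mul-x+ (- + suc m) (falling (suc m)))  ≡⟨ head-mul-x+ (falling (suc m)) ⟩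
    - + suc m * head (falling (suc m))           ≡⟨ cong (- + suc m *_) (head-falling m) ⟩
    - + suc m * + 0                              ≡⟨ ℤₚ.*-zeroʳ (- + suc m) ⟩
    + 0                                          ∎
    where
      open ≡-Reasoning
      head-mul-x+ : ∀ {k c} (V : Vec ℤ (suc k)) → head (mul-x+ c V) ≡ c * head V
      head-mul-x+ (_ ∷ _) = refl

  mul-x+^ : ∀ {d} → ℤ → (a : ℕ) → Vec ℤ (suc d) → Vec ℤ (suc (a ℕ.+ d))
  mul-x+^ c zero    V = V
  mul-x+^ c (suc a) V = mul-x+ c (mul-x+^ c a V)

  lead-mul-x+^ : ∀ {d} c a (V : Vec ℤ (suc d)) → lead (mul-x+^ c a V) ≡ lead V
  lead-mul-x+^ c zero    V = refl
  lead-mul-x+^ c (suc a) V = trans (lead-mul-x+ c (mul-x+^ c a V)) (lead-mul-x+^ c a V)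

  ∏[x+e]^a : ∀ m → (a e : Fin m → ℕ) → Vec ℤ (suc (Σ[<] m a))
  ∏[x+e]^a zero    a e = + 1 ∷ []
  ∏[x+e]^a (suc m) a e = mul-x+^ (+ e Fin.zero) (a Fin.zero) (∏[x+e]^a m (a ∘ Fin.suc) (e ∘ Fin.suc))

  lead-∏[x+e]^a : ∀ m (a e : Fin m → ℕ) → lead (∏[x+e]^a m a e) ≡ + 1
  lead-∏[x+e]^a zero    a e = refl
  lead-∏[x+e]^a (suc m) a e = trans (lead-mul-x+^ _ (a Fin.zero) _) (lead-∏[x+e]^a m (a ∘ Fin.suc) (e ∘ Fin.suc))

module Congruence (m : ℕ) where
  open import Data.Integer using (ℤ; +_; -_; _+_; _*_; _-_)
  import Data.Integer.Properties as ℤₚ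
  open import Data.Integer.Tactic.RingSolver using (solve-∀)
  open import Data.Integer.Divisibility.Signed using (_∣_; divides; ∣m∣n⇒∣m+n; ∣m⇒∣-m; ∣m∣n⇒∣m-n; ∣n⇒∣m*n)
  open import Data.Nat.DivMod using (_/_; m≡m%n+[m/n]*n)
  open import Data.Vec using (Vec; []; _∷_)
  open import Relation.Binary.Bundles using (Setoid)
  import Relation.Binary.Reasoning.Setoid as SetoidReasoning
  open import Relation.Binary.PropositionalEquality using (subst)
  open Sequences

  infix 4 _≈_
  record _≈_ (a b : ℤ) : Set where
    constructor mk≈
    field m∣a-b : + m ∣ a - b

  ≈-refl : ∀ {a} → a ≈ a
  ≈-refl {a} = mk≈ (divides (+ 0) (ℤₚ.+-inverseʳ a))

  ≈-reflexive : ∀ {a b} → a ≡ b → a ≈ b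
  ≈-reflexive refl = ≈-refl

  ≈-sym : ∀ {a b} → a ≈ b → b ≈ a
  ≈-sym {a} {b} (mk≈ m∣a-b) = mk≈ (subst (+ m ∣_) (negate a b) (∣m⇒∣-m m∣a-b))
    where negate : ∀ a b → - (a - b) ≡ b - a
          negate = solve-∀

  ≈-trans : ∀ {a b c} → a ≈ b → b ≈ c → a ≈ c
  ≈-trans {a} {b} {c} (mk≈ m∣a-b) (mk≈ m∣b-c) = mk≈ (subst (+ m ∣_) (telescope a b c) (∣m∣n⇒∣m+n m∣a-b m∣b-c))
    where telescope : ∀ a b c → (a - b) + (b - c) ≡ a - c
          telescope = solve-∀

  ≈-setoid : Setoid _ _
  ≈-setoid = record { _≈_ = _≈_ ; isEquivalence = record { refl = ≈-refl ; sym = ≈-sym ; trans = ≈-trans } }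

  module ≈-Reasoning = SetoidReasoning ≈-setoid

  +-cong : ∀ {a b c d} → a ≈ b → c ≈ d → a + c ≈ b + d
  +-cong {a} {b} {c} {d} (mk≈ m∣a-b) (mk≈ m∣c-d) = mk≈ (subst (+ m ∣_) (regroup a b c d) (∣m∣n⇒∣m+n m∣a-b m∣c-d))
    where regroup : ∀ a b c d → (a - b) + (c - d) ≡ (a + c) - (b + d)
          regroup = solve-∀

  sub-cong : ∀ {a b c d} → a ≈ b → c ≈ d → a - c ≈ b - d
  sub-cong {a} {b} {c} {d} (mk≈ m∣a-b) (mk≈ m∣c-d) = mk≈ (subst (+ m ∣_) (regroup a b c d) (∣m∣n⇒∣m-n m∣a-b m∣c-d))
    where regroup : ∀ a b c d → (a - b) - (c - d) ≡ (a - c) - (b - d)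
          regroup = solve-∀

  *-congˡ : ∀ c {a b} → a ≈ b → c * a ≈ c * b
  *-congˡ c {a} {b} (mk≈ m∣a-b) = mk≈ (subst (+ m ∣_) (distrib c a b) (∣n⇒∣m*n c m∣a-b))
    where distrib : ∀ c a b → c * (a - b) ≡ c * a - c * b
          distrib = solve-∀

  m*x≈0 : ∀ x → + m * x ≈ + 0
  m*x≈0 x = mk≈ (divides x (trans (ℤₚ.+-identityʳ _) (ℤₚ.*-comm (+ m) x)))

  ≈0⇒∣ : ∀ {a} → a ≈ + 0 → + m ∣ a
  ≈0⇒∣ {a} (mk≈ m∣a-0) = subst (+ m ∣_) (ℤₚ.+-identityʳ a) m∣a-0

  ∣⇒≈0 : ∀ {a} → + m ∣ a → a ≈ + 0
  ∣⇒≈0 {a} m∣a = mk≈ (subst (+ m ∣_) (sym (ℤₚ.+-identityʳ a)) m∣a)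

  %-≡⇒≈ : .{{_ : NonZero m}} → ∀ x y → x % m ≡ y % m → + x ≈ + y
  %-≡⇒≈ x y x%m≡y%m = mk≈ (divides (+ (x / m) - + (y / m)) (begin
    + x - + y                                                ≡⟨ cong₂ _-_ (as-ℤ x) (as-ℤ y) ⟩
    (+ (x % m) + + (x / m) * + m) - (+ (y % m) + + (y / m) * + m)
      ≡⟨ cong (λ r → (+ r + + (x / m) * + m) - (+ (y % m) + + (y / m) * + m)) x%m≡y%m ⟩
    (+ (y % m) + + (x / m) * + m) - (+ (y % m) + + (y / m) * + m)
      ≡⟨ cancel (+ (y % m)) (+ (x / m)) (+ (y / m)) (+ m) ⟩
    (+ (x / m) - + (y / m)) * + m                            ∎))
    where
      open ≡-Reasoning
      as-ℤ : ∀ z → + z ≡ + (z % m) + + (z / m) * + m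
      as-ℤ z = trans (cong +_ (m≡m%n+[m/n]*n z m)) (trans (ℤₚ.pos-+ (z % m) _) (cong (_+_ (+ (z % m))) (ℤₚ.pos-* (z / m) m)))
      cancel : ∀ r a b m → (r + a * m) - (r + b * m) ≡ (a - b) * m
      cancel = solve-∀

  ∑-≈0 : ∀ n (f : Seq) → (∀ k → k < n → f k ≈ + 0) → ∑ n f ≈ + 0
  ∑-≈0 zero    f f≈0 = ≈-refl
  ∑-≈0 (suc n) f f≈0 = +-cong (f≈0 0 (s≤s z≤n)) (∑-≈0 n (f ∘ suc) (λ k k<n → f≈0 (suc k) (s≤s k<n)))

  T-≈ : ∀ {g h : Seq} → (∀ k → g k ≈ h k) → ∀ n → T g n ≈ T h n
  T-≈ g≈h zero    = g≈h 0
  T-≈ g≈h (suc n) = +-cong (T-≈ g≈h n) (T-≈ (g≈h ∘ suc) n)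

  T-≈0 : ∀ (g : Seq) n → (∀ k → k ≤ n → g k ≈ + 0) → T g n ≈ + 0
  T-≈0 g zero    g≈0 = g≈0 0 z≤n
  T-≈0 g (suc n) g≈0 = +-cong (T-≈0 g n (λ k k≤n → g≈0 k (ℕₚ.m≤n⇒m≤1+n k≤n)))
                             (T-≈0 (g ∘ suc) n (λ k k≤n → g≈0 (suc k) (s≤s k≤n)))

  T-injective : ∀ (g : Seq) → (∀ n → T g n ≈ + 0) → ∀ n → g n ≈ + 0
  T-injective g Tg≈0 zero    = Tg≈0 0
  T-injective g Tg≈0 (suc n) = T-injective (g ∘ suc) T[g∘suc]≈0 n
    where
      T[g∘suc]≈0 : ∀ k → T (g ∘ suc) k ≈ + 0
      T[g∘suc]≈0 k = ≈-trans (≈-reflexive (difference (T g k) (T (g ∘ suc) k))) (sub-cong (Tg≈0 (suc k)) (Tg≈0 k))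
        where difference : ∀ a b → b ≡ (a + b) - a
              difference = solve-∀

  ⟦⟧-≈ : ∀ {k} (V : Vec ℤ k) {f g : Seq} → (∀ j → f j ≈ g j) → ∀ n → ⟦ V ⟧ f n ≈ ⟦ V ⟧ g n
  ⟦⟧-≈ []       f≈g n = ≈-refl
  ⟦⟧-≈ (c ∷ cs) f≈g n = +-cong (*-congˡ c (f≈g n)) (⟦⟧-≈ cs f≈g (suc n))

  recurrence-≈0 : ∀ (w : Seq) → w 0 ≈ + 0 → (∀ n → w (suc n) ≈ T w n) → ∀ n → w n ≈ + 0
  recurrence-≈0 w w₀≈0 w-rec n = upTo n n ℕₚ.≤-refl
    where
      upTo : ∀ n j → j ≤ n → w j ≈ + 0
      upTo n       zero    _         = w₀≈0
      upTo (suc n) (suc j) (s≤s j≤n) = ≈-trans (w-rec j) (T-≈0 w j (λ i i≤j → upTo n i (ℕₚ.≤-trans i≤j j≤n)))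

  recurrence-≈-𝐁 : ∀ (g : Seq) → (∀ n → g (suc n) ≈ T g n) → ∀ n → g n ≈ g 0 * 𝐁 n
  recurrence-≈-𝐁 g g-rec n = ≈-trans (≈-reflexive (split (g n) (g 0 * 𝐁 n))) (≈-trans (+-cong (recurrence-≈0 w w₀≈0 w-rec n) ≈-refl) (≈-reflexive (ℤₚ.+-identityˡ _)))
    where
      split : ∀ a b → a ≡ (a - b) + b
      split = solve-∀
      w : Seq
      w j = g j - g 0 * 𝐁 j
      w₀≈0 : w 0 ≈ + 0
      w₀≈0 = ≈-reflexive (vanish (g 0))
        where vanish : ∀ a → a - a * + 1 ≡ + 0
              vanish = solve-∀
      w-rec : ∀ n → w (suc n) ≈ T w n
      w-rec n = begin
        g (suc n) - g 0 * 𝐁 (suc n)             ≈⟨ sub-cong (g-rec n) (≈-reflexive (cong (g 0 *_) (𝐁-suc n))) ⟩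
        T g n - g 0 * T 𝐁 n                     ≡⟨ minus (T g n) (g 0) (T 𝐁 n) ⟩
        T g n + - g 0 * T 𝐁 n                   ≡⟨ cong (_+_ (T g n)) (T-* (- g 0) 𝐁 n) ⟨
        T g n + T (λ k → - g 0 * 𝐁 k) n         ≡⟨ T-+ g (λ k → - g 0 * 𝐁 k) n ⟨
        T (λ k → g k + - g 0 * 𝐁 k) n           ≡⟨ T-cong (λ k → minus (g k) (g 0) (𝐁 k)) n ⟨
        T w n ∎
        where
          open ≈-Reasoning
          minus : ∀ a c b → a - c * b ≡ a + - c * b
          minus = solve-∀

module BellModPrime (q : ℕ) (p-prime : Prime (suc (suc q))) where
  open import Data.Integer using (ℤ; +_; -_; _+_; _*_; _-_; ∣_∣)
  import Data.Integer.Properties as ℤₚ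
  open import Data.Integer.Tactic.RingSolver using (solve-∀)
  open import Data.Integer.Divisibility.Signed using (_∣_; ∣m⇒∣m*n; ∣ᵤ⇒∣; ∣⇒∣ᵤ)
  open import Data.Nat.Divisibility using (∣⇒≤) renaming (_∣_ to _∣ℕ_)
  import Data.Nat.Tactic.RingSolver as NatSolver
  open import Data.Nat.Primality using (euclidsLemma)
  open import Data.Nat.Combinatorics using (nCn≡1)
  open import Data.Sum using (inj₁; inj₂)
  open import Relation.Nullary using (¬_; yes; no)
  open import Relation.Binary.PropositionalEquality using (subst)
  open import Data.Fin.Properties using (toℕ<n)
  open import Data.Vec using (Vec; []; _∷_; head)
  open import Data.Vec.Relation.Unary.All using (All; []; _∷_)
  open Sequences
  open Binomial using (prime∣pCk)

  -- p is written as q + 2 so that x^p − x − 1 is x^[2+k]-x-1 q, a vector of length p + 1.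
  p : ℕ
  p = suc (suc q)

  open Congruence p

  p∤small : ∀ {k} → 0 < k → k < p → ¬ (+ p ∣ + k)
  p∤small 0<k k<p p∣k = ℕₚ.<⇒≱ k<p (∣⇒≤ {{ℕ.>-nonZero 0<k}} (∣⇒∣ᵤ p∣k))

  p∤-* : ∀ {x y} → ¬ (+ p ∣ x) → ¬ (+ p ∣ y) → ¬ (+ p ∣ x * y)
  p∤-* {x} {y} p∤x p∤y p∣xy with euclidsLemma ∣ x ∣ ∣ y ∣ p-prime (subst (p ∣ℕ_) (ℤₚ.abs-* x y) (∣⇒∣ᵤ p∣xy))
  ... | inj₁ p∣x = p∤x (∣ᵤ⇒∣ p∣x)
  ... | inj₂ p∣y = p∤y (∣ᵤ⇒∣ p∣y)

  k*x≈0⇒x≈0 : ∀ {k} x → 0 < k → k < p → + k * x ≈ + 0 → x ≈ + 0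
  k*x≈0⇒x≈0 {k} x 0<k k<p kx≈0 with euclidsLemma k ∣ x ∣ p-prime (subst (p ∣ℕ_) (ℤₚ.abs-* (+ k) x) (∣⇒∣ᵤ (≈0⇒∣ kx≈0)))
  ... | inj₁ p∣k = ⊥-elim (p∤small 0<k k<p (∣ᵤ⇒∣ p∣k))
  ... | inj₂ p∣x = ∣⇒≈0 (∣ᵤ⇒∣ p∣x)

  1≉0 : ¬ (+ 1 ≈ + 0)
  1≉0 1≈0 = p∤small (s≤s z≤n) (s≤s (s≤s z≤n)) (≈0⇒∣ 1≈0)

  T-at-p : ∀ (h : Seq) → T h p ≈ h 0 + h p
  T-at-p h = begin
    T h p                                      ≡⟨ T-∑ p (suc p) h ℕₚ.≤-refl ⟨
    + 1 * h 0 + ∑ p f                          ≡⟨ cong (_+_ (+ 1 * h 0)) (∑-init-last (suc q) f) ⟩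
    + 1 * h 0 + (∑ (suc q) f + f (suc q))      ≈⟨ +-cong (≈-refl {+ 1 * h 0}) (+-cong (∑-≈0 (suc q) f inner≈0) (≈-refl {f (suc q)})) ⟩
    + 1 * h 0 + (+ 0 + + (p C p) * h p)        ≡⟨ cong (λ c → + 1 * h 0 + (+ 0 + + c * h p)) (nCn≡1 p) ⟩
    + 1 * h 0 + (+ 0 + + 1 * h p)              ≡⟨ simplify (h 0) (h p) ⟩
    h 0 + h p                                  ∎
    where
      open ≈-Reasoning
      f : Seq
      f k = + (p C suc k) * h (suc k)
      inner≈0 : ∀ k → k < suc q → f k ≈ + 0
      inner≈0 k k<q+1 = ∣⇒≈0 (∣m⇒∣m*n (h (suc k)) (∣ᵤ⇒∣ {+ p} {+ (p C suc k)} (prime∣pCk p-prime (s≤s k<q+1))))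
      simplify : ∀ a b → + 1 * a + (+ 0 + + 1 * b) ≡ a + b
      simplify = solve-∀

  T^p≈id : ∀ n (g : Seq) → T^ p g n ≈ g n
  T^p≈id zero    g = ≈-reflexive (T^-at-0 p g)
  T^p≈id (suc n) g = begin
    T^ p g (suc n)                               ≡⟨ T^-suc p g n ⟩
    T^ p (λ k → g (suc k) + + p * g k) n         ≡⟨ T^-+ p (g ∘ suc) (λ k → + p * g k) n ⟩
    T^ p (g ∘ suc) n + T^ p (λ k → + p * g k) n  ≡⟨ cong (_+_ (T^ p (g ∘ suc) n)) (T^-* p (+ p) g n) ⟩
    T^ p (g ∘ suc) n + + p * T^ p g n            ≈⟨ +-cong (T^p≈id n (g ∘ suc)) (m*x≈0 (T^ p g n)) ⟩
    g (suc n) + + 0                              ≡⟨ ℤₚ.+-identityʳ (g (suc n)) ⟩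
    g (suc n)                                    ∎
    where open ≈-Reasoning

  Annihilates : ∀ {k} → Vec ℤ k → Set
  Annihilates V = ∀ n → ⟦ V ⟧ 𝐁 n ≈ + 0

  Annihilates-Δ : ∀ {k} (V : Vec ℤ (suc k)) → Annihilates V → Annihilates (Δ V)
  Annihilates-Δ V ann n = begin
    ⟦ Δ V ⟧ 𝐁 n              ≡⟨ difference (⟦ Δ V ⟧ 𝐁 n) (⟦ V ⟧ 𝐁 n) ⟩
    h n - ⟦ V ⟧ 𝐁 n          ≈⟨ sub-cong (T-injective h Th≈0 n) (ann n) ⟩
    + 0 - + 0                ≡⟨⟩
    + 0                      ∎
    where
      open ≈-Reasoning
      h : Seq
      h j = ⟦ Δ V ⟧ 𝐁 j + ⟦ V ⟧ 𝐁 j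
      Th≈0 : ∀ n → T h n ≈ + 0
      Th≈0 n = ≈-trans (≈-reflexive (sym (⟦⟧-suc 𝐁-suc V n))) (ann (suc n))
      difference : ∀ x y → x ≡ (x + y) - y
      difference = solve-∀

  Annihilates-init : ∀ {k} (V : Vec ℤ (suc k)) → Annihilates V → lead V ≈ + 0 → Annihilates (init V)
  Annihilates-init {k} V ann lead≈0 n = begin
    ⟦ init V ⟧ 𝐁 n                                                ≡⟨ difference (⟦ init V ⟧ 𝐁 n) (lead V * 𝐁 (n ℕ.+ k)) ⟩
    (⟦ init V ⟧ 𝐁 n + lead V * 𝐁 (n ℕ.+ k)) - lead V * 𝐁 (n ℕ.+ k) ≡⟨ cong (_- lead V * 𝐁 (n ℕ.+ k)) (⟦⟧-init V 𝐁 n) ⟨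
    ⟦ V ⟧ 𝐁 n - lead V * 𝐁 (n ℕ.+ k)                              ≡⟨ cong (_-_ (⟦ V ⟧ 𝐁 n)) (ℤₚ.*-comm (lead V) _) ⟩
    ⟦ V ⟧ 𝐁 n - 𝐁 (n ℕ.+ k) * lead V                              ≈⟨ sub-cong (ann n) (*-congˡ (𝐁 (n ℕ.+ k)) lead≈0) ⟩
    + 0 - 𝐁 (n ℕ.+ k) * + 0                                        ≡⟨ cong (_-_ (+ 0)) (ℤₚ.*-zeroʳ (𝐁 (n ℕ.+ k))) ⟩
    + 0                                                            ∎
    where
      open ≈-Reasoning
      difference : ∀ x y → x ≡ (x + y) - y
      difference = solve-∀

  lead-annihilator≈0 : ∀ {k} → k < p → (V : Vec ℤ (suc k)) → Annihilates V → lead V ≈ + 0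
  lead-annihilator≈0 {zero}  _   (c ∷ []) ann = ≈-trans (≈-reflexive (unit c)) (ann 0)
    where unit : ∀ c → c ≡ c * + 1 + + 0
          unit = solve-∀
  lead-annihilator≈0 {suc k} k<p V        ann =
    k*x≈0⇒x≈0 (lead V) (s≤s z≤n) k<p
      (≈-trans (≈-reflexive (sym (lead-Δ V))) (lead-annihilator≈0 (ℕₚ.<-trans (ℕₚ.n<1+n k) k<p) (Δ V) (Annihilates-Δ V ann)))

  All-init : ∀ {ℓ} {P : ℤ → Set ℓ} {k} (V : Vec ℤ (suc k)) → All P (init V) → P (lead V) → All P V
  All-init (c ∷ [])         []         P-lead = P-lead ∷ []
  All-init (c ∷ cs@(_ ∷ _)) (Pc ∷ Pcs) P-lead = Pc ∷ All-init cs Pcs P-lead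

  All-head : ∀ {ℓ} {P : ℤ → Set ℓ} {k} (V : Vec ℤ (suc k)) → All P V → P (head V)
  All-head (_ ∷ _) (P-head ∷ _) = P-head

  annihilator≈0 : ∀ {k} → k ≤ p → (V : Vec ℤ k) → Annihilates V → All (_≈ + 0) V
  annihilator≈0 _   []          _   = []
  annihilator≈0 k<p V@(_ ∷ _) ann =
    All-init V (annihilator≈0 (ℕₚ.<⇒≤ k<p) (init V) (Annihilates-init V ann lead≈0)) lead≈0
    where lead≈0 = lead-annihilator≈0 k<p V ann

  annihilator-of-degree-p≈0 : (V : Vec ℤ (suc p)) → Annihilates V → lead V ≈ + 0 → All (_≈ + 0) V
  annihilator-of-degree-p≈0 V ann lead≈0 =
    All-init V (annihilator≈0 ℕₚ.≤-refl (init V) (Annihilates-init V ann lead≈0)) lead≈0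

  touchard-defect : Seq
  touchard-defect n = 𝐁 (n ℕ.+ p) - 𝐁 (suc n) - 𝐁 n

  touchard-defect-rec : ∀ n → touchard-defect (suc n) ≈ T touchard-defect n
  touchard-defect-rec n = begin
    𝐁 (suc n ℕ.+ p) - 𝐁 (2 ℕ.+ n) - 𝐁 (suc n)
      ≡⟨ cong₂ (λ a b → a - b - 𝐁 (suc n)) (trans (𝐁-suc (n ℕ.+ p)) (T-vandermonde p 𝐁 n)) (trans (𝐁-suc (suc n)) (T-suc 𝐁 n)) ⟩
    T (λ k → T (λ j → 𝐁 (k ℕ.+ j)) p) n - T (λ k → 𝐁 (suc k) + 𝐁 k) n - 𝐁 (suc n)
      ≈⟨ sub-cong (sub-cong (T-≈ (λ k → T-at-p (λ j → 𝐁 (k ℕ.+ j))) n) ≈-refl) (≈-reflexive (𝐁-suc n)) ⟩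
    T (λ k → 𝐁 (k ℕ.+ 0) + 𝐁 (k ℕ.+ p)) n - T (λ k → 𝐁 (suc k) + 𝐁 k) n - T 𝐁 n
      ≡⟨ cong (_- T 𝐁 n) (T-- (λ k → 𝐁 (k ℕ.+ 0) + 𝐁 (k ℕ.+ p)) (λ k → 𝐁 (suc k) + 𝐁 k) n) ⟨
    T (λ k → 𝐁 (k ℕ.+ 0) + 𝐁 (k ℕ.+ p) - (𝐁 (suc k) + 𝐁 k)) n - T 𝐁 n
      ≡⟨ T-- (λ k → 𝐁 (k ℕ.+ 0) + 𝐁 (k ℕ.+ p) - (𝐁 (suc k) + 𝐁 k)) 𝐁 n ⟨
    T (λ k → 𝐁 (k ℕ.+ 0) + 𝐁 (k ℕ.+ p) - (𝐁 (suc k) + 𝐁 k) - 𝐁 k) n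
      ≡⟨ T-cong (λ k → trans (cong (λ i → 𝐁 i + 𝐁 (k ℕ.+ p) - (𝐁 (suc k) + 𝐁 k) - 𝐁 k) (ℕₚ.+-identityʳ k))
                             (regroup (𝐁 k) (𝐁 (k ℕ.+ p)) (𝐁 (suc k)))) n ⟩
    T touchard-defect n ∎
    where
      open ≈-Reasoning
      regroup : ∀ a b c → a + b - (c + a) - a ≡ b - c - a
      regroup = solve-∀

  falling[p]-1-annihilates : Annihilates (falling p ⊖ const p (+ 1))
  falling[p]-1-annihilates n = begin
    ⟦ falling p ⊖ const p (+ 1) ⟧ 𝐁 n           ≡⟨ ⟦⟧-⊖ (falling p) (const p (+ 1)) 𝐁 n ⟩
    ⟦ falling p ⟧ 𝐁 n - ⟦ const p (+ 1) ⟧ 𝐁 n   ≡⟨ cong₂ _-_ (⟦⟧-falling 𝐁-suc p n) (trans (⟦⟧-const p (+ 1) 𝐁 n) (ℤₚ.*-identityˡ (𝐁 n))) ⟩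
    T^ p 𝐁 n - 𝐁 n                              ≈⟨ sub-cong (T^p≈id n 𝐁) ≈-refl ⟩
    𝐁 n - 𝐁 n                                   ≡⟨ ℤₚ.+-inverseʳ (𝐁 n) ⟩
    + 0                                         ∎
    where open ≈-Reasoning

  x^p-x-1-u₀-annihilates : Annihilates (x^[2+k]-x-1 q ⊖ const p (touchard-defect 0))
  x^p-x-1-u₀-annihilates n = begin
    ⟦ x^[2+k]-x-1 q ⊖ const p (u 0) ⟧ 𝐁 n            ≡⟨ ⟦⟧-⊖ (x^[2+k]-x-1 q) (const p (u 0)) 𝐁 n ⟩
    ⟦ x^[2+k]-x-1 q ⟧ 𝐁 n - ⟦ const p (u 0) ⟧ 𝐁 n    ≡⟨ cong₂ _-_ (⟦⟧-x^[2+k]-x-1 q 𝐁 n) (⟦⟧-const p (u 0) 𝐁 n) ⟩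
    u n - u 0 * 𝐁 n                                 ≈⟨ sub-cong (recurrence-≈-𝐁 u touchard-defect-rec n) ≈-refl ⟩
    u 0 * 𝐁 n - u 0 * 𝐁 n                           ≡⟨ ℤₚ.+-inverseʳ (u 0 * 𝐁 n) ⟩
    + 0                                             ∎
    where
      open ≈-Reasoning
      u = touchard-defect

  touchard-defect₀≈0 : touchard-defect 0 ≈ + 0
  touchard-defect₀≈0 = ≈-trans (≈-reflexive (sym head≡u₀)) (All-head V (annihilator-of-degree-p≈0 V ann lead≈0))
    where
      u₀ = touchard-defect 0
      A₁ A₂ V : Vec ℤ (suc p)
      A₁ = falling p ⊖ const p (+ 1)
      A₂ = x^[2+k]-x-1 q ⊖ const p u₀
      V  = A₁ ⊖ A₂
      ann : Annihilates V
      ann n = ≈-trans (≈-reflexive (⟦⟧-⊖ A₁ A₂ 𝐁 n)) (sub-cong (falling[p]-1-annihilates n) (x^p-x-1-u₀-annihilates n))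
      lead≈0 : lead V ≈ + 0
      lead≈0 = ≈-reflexive (begin
        lead V                                                  ≡⟨ lead-⊖ A₁ A₂ ⟩
        lead A₁ - lead A₂                                       ≡⟨ cong₂ _-_ (lead-⊖ (falling p) (const p (+ 1))) (lead-⊖ (x^[2+k]-x-1 q) (const p u₀)) ⟩
        (lead (falling p) - lead (const p (+ 1))) - (lead (x^[2+k]-x-1 q) - lead (const p u₀))
          ≡⟨ cong₂ (λ a b → (a - lead (const p (+ 1))) - (b - lead (const p u₀))) (lead-falling p) (lead-x^[2+k]-x-1 q) ⟩
        (+ 1 - lead (const p (+ 1))) - (+ 1 - lead (const p u₀))
          ≡⟨ cong₂ (λ a b → (+ 1 - a) - (+ 1 - b)) (lead-const (suc q) (+ 1)) (lead-const (suc q) u₀) ⟩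
        + 0                                                     ∎)
        where open ≡-Reasoning
      head≡u₀ : head V ≡ u₀
      head≡u₀ = begin
        head V                                             ≡⟨ trans (head-⊖ A₁ A₂) (cong (_- head A₂) (head-⊖ (falling p) (const p (+ 1)))) ⟩
        (head (falling p) - + 1) - ((+ 0 - + 0 - + 1) - u₀)  ≡⟨ cong (λ h → (h - + 1) - ((+ 0 - + 0 - + 1) - u₀)) (head-falling (suc q)) ⟩
        (+ 0 - + 1) - ((+ 0 - + 0 - + 1) - u₀)             ≡⟨ simplify u₀ ⟩
        u₀                                                 ∎
        where
          open ≡-Reasoning
          simplify : ∀ a → (+ 0 - + 1) - ((+ 0 - + 0 - + 1) - a) ≡ a
          simplify = solve-∀

  touchard : ∀ n → 𝐁 (n ℕ.+ p) ≈ 𝐁 (suc n) + 𝐁 n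
  touchard n = begin
    𝐁 (n ℕ.+ p)                                      ≡⟨ split (𝐁 (n ℕ.+ p)) (𝐁 (suc n)) (𝐁 n) ⟩
    touchard-defect n + (𝐁 (suc n) + 𝐁 n)            ≈⟨ +-cong (recurrence-≈-𝐁 touchard-defect touchard-defect-rec n) ≈-refl ⟩
    touchard-defect 0 * 𝐁 n + (𝐁 (suc n) + 𝐁 n)      ≈⟨ +-cong (≈-trans (≈-reflexive (ℤₚ.*-comm _ (𝐁 n))) (*-congˡ (𝐁 n) touchard-defect₀≈0)) ≈-refl ⟩
    𝐁 n * + 0 + (𝐁 (suc n) + 𝐁 n)                    ≡⟨ cong (_+ (𝐁 (suc n) + 𝐁 n)) (ℤₚ.*-zeroʳ (𝐁 n)) ⟩
    + 0 + (𝐁 (suc n) + 𝐁 n)                          ≡⟨ ℤₚ.+-identityˡ _ ⟩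
    𝐁 (suc n) + 𝐁 n                                  ∎
    where
      open ≈-Reasoning
      split : ∀ a b c → a ≡ (a - b - c) + (b + c)
      split = solve-∀

  TouchardStep : ℕ → Seq → Set
  TouchardStep s g = ∀ n → g (n ℕ.+ s ℕ.* p) ≈ g (n ℕ.+ s) + g n

  TouchardStep-iterate : ∀ s (g : Seq) → TouchardStep s g → ∀ m n → g (n ℕ.+ s ℕ.* p ℕ.* m) ≈ T (λ j → g (n ℕ.+ s ℕ.* j)) m
  TouchardStep-iterate s g step zero    n = ≈-reflexive (cong g (both-n n s p))
    where both-n : ∀ n s p → n ℕ.+ s ℕ.* p ℕ.* 0 ≡ n ℕ.+ s ℕ.* 0
          both-n = NatSolver.solve-∀
  TouchardStep-iterate s g step (suc m) n = begin
    g (n ℕ.+ s ℕ.* p ℕ.* suc m)                              ≡⟨ cong g (shift₁ n s p m) ⟩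
    g (n ℕ.+ s ℕ.* p ℕ.+ s ℕ.* p ℕ.* m)                      ≈⟨ TouchardStep-iterate s g step m (n ℕ.+ s ℕ.* p) ⟩
    T (λ j → g (n ℕ.+ s ℕ.* p ℕ.+ s ℕ.* j)) m                ≈⟨ T-≈ (λ j → ≈-trans (≈-reflexive (cong g (shift₂ n s p j))) (step (n ℕ.+ s ℕ.* j))) m ⟩
    T (λ j → g (n ℕ.+ s ℕ.* j ℕ.+ s) + g (n ℕ.+ s ℕ.* j)) m  ≡⟨ T-cong (λ j → cong (λ i → g i + g (n ℕ.+ s ℕ.* j)) (shift₃ n s j)) m ⟩
    T (λ j → g (n ℕ.+ s ℕ.* suc j) + g (n ℕ.+ s ℕ.* j)) m    ≡⟨ T-suc (λ j → g (n ℕ.+ s ℕ.* j)) m ⟨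
    T (λ j → g (n ℕ.+ s ℕ.* j)) (suc m)                      ∎
    where
      open ≈-Reasoning
      shift₁ : ∀ n s p m → n ℕ.+ s ℕ.* p ℕ.* suc m ≡ n ℕ.+ s ℕ.* p ℕ.+ s ℕ.* p ℕ.* m
      shift₁ = NatSolver.solve-∀
      shift₂ : ∀ n s p j → n ℕ.+ s ℕ.* p ℕ.+ s ℕ.* j ≡ n ℕ.+ s ℕ.* j ℕ.+ s ℕ.* p
      shift₂ = NatSolver.solve-∀
      shift₃ : ∀ n s j → n ℕ.+ s ℕ.* j ℕ.+ s ≡ n ℕ.+ s ℕ.* suc j
      shift₃ = NatSolver.solve-∀

  TouchardStep-*p : ∀ s (g : Seq) → TouchardStep s g → TouchardStep (s ℕ.* p) g
  TouchardStep-*p s g step n = begin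
    g (n ℕ.+ s ℕ.* p ℕ.* p)                  ≈⟨ TouchardStep-iterate s g step p n ⟩
    T (λ j → g (n ℕ.+ s ℕ.* j)) p            ≈⟨ T-at-p (λ j → g (n ℕ.+ s ℕ.* j)) ⟩
    g (n ℕ.+ s ℕ.* 0) + g (n ℕ.+ s ℕ.* p)    ≡⟨ cong (λ i → g i + g (n ℕ.+ s ℕ.* p)) (no-shift n s) ⟩
    g n + g (n ℕ.+ s ℕ.* p)                  ≡⟨ ℤₚ.+-comm (g n) _ ⟩
    g (n ℕ.+ s ℕ.* p) + g n                  ∎
    where
      open ≈-Reasoning
      no-shift : ∀ n s → n ℕ.+ s ℕ.* 0 ≡ n
      no-shift = NatSolver.solve-∀

  TouchardStep-p^ : ∀ k s (g : Seq) → TouchardStep s g → ∀ n → g (n ℕ.+ s ℕ.* p ℕ.^ k) ≈ g (n ℕ.+ s) + + k * g n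
  TouchardStep-p^ zero    s g step n = ≈-reflexive (trans (cong (λ i → g (n ℕ.+ i)) (ℕₚ.*-identityʳ s)) (sym (ℤₚ.+-identityʳ _)))
  TouchardStep-p^ (suc k) s g step n = begin
    g (n ℕ.+ s ℕ.* (p ℕ.* p ℕ.^ k))            ≡⟨ cong (λ i → g (n ℕ.+ i)) (ℕₚ.*-assoc s p (p ℕ.^ k)) ⟨
    g (n ℕ.+ s ℕ.* p ℕ.* p ℕ.^ k)              ≈⟨ TouchardStep-p^ k (s ℕ.* p) g (TouchardStep-*p s g step) n ⟩
    g (n ℕ.+ s ℕ.* p) + + k * g n            ≈⟨ +-cong (step n) ≈-refl ⟩
    g (n ℕ.+ s) + g n + + k * g n            ≡⟨ ℤₚ.+-assoc (g (n ℕ.+ s)) (g n) _ ⟩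
    g (n ℕ.+ s) + (g n + + k * g n)          ≡⟨ cong (_+_ (g (n ℕ.+ s))) (1+m*x≡x+m*x k (g n)) ⟨
    g (n ℕ.+ s) + + suc k * g n              ∎
    where open ≈-Reasoning

  ⟦⟧-touchardStep : ∀ {k} (V : Vec ℤ k) → TouchardStep 1 (⟦ V ⟧ 𝐁)
  ⟦⟧-touchardStep V n = begin
    ⟦ V ⟧ 𝐁 (n ℕ.+ 1 ℕ.* p)                       ≡⟨ cong (λ i → ⟦ V ⟧ 𝐁 (n ℕ.+ i)) (ℕₚ.*-identityˡ p) ⟩
    ⟦ V ⟧ 𝐁 (n ℕ.+ p)                             ≡⟨ ⟦⟧-shift V 𝐁 p n ⟨
    ⟦ V ⟧ (λ j → 𝐁 (j ℕ.+ p)) n                   ≈⟨ ⟦⟧-≈ V touchard n ⟩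
    ⟦ V ⟧ (λ j → 𝐁 (suc j) + 𝐁 j) n               ≡⟨ ⟦⟧-+ V (𝐁 ∘ suc) 𝐁 n ⟩
    ⟦ V ⟧ (𝐁 ∘ suc) n + ⟦ V ⟧ 𝐁 n                 ≡⟨ cong (_+ ⟦ V ⟧ 𝐁 n) (trans (⟦⟧-cong V (λ j → cong 𝐁 (ℕₚ.+-comm 1 j)) n) (⟦⟧-shift V 𝐁 1 n)) ⟩
    ⟦ V ⟧ 𝐁 (n ℕ.+ 1) + ⟦ V ⟧ 𝐁 n                 ∎
    where open ≈-Reasoning

  ⟦⟧-mul-x+^ : ∀ {d} k a (V : Vec ℤ (suc d)) n → ⟦ mul-x+^ (+ k) a V ⟧ 𝐁 n ≈ ⟦ V ⟧ 𝐁 (n ℕ.+ a ℕ.* p ℕ.^ k)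
  ⟦⟧-mul-x+^ k zero    V n = ≈-reflexive (cong (⟦ V ⟧ 𝐁) (sym (ℕₚ.+-identityʳ n)))
  ⟦⟧-mul-x+^ k (suc a) V n = begin
    ⟦ mul-x+ (+ k) W ⟧ 𝐁 n                                          ≡⟨ ⟦⟧-mul-x+ (+ k) W 𝐁 n ⟩
    ⟦ W ⟧ 𝐁 (suc n) + + k * ⟦ W ⟧ 𝐁 n                              ≈⟨ +-cong (⟦⟧-mul-x+^ k a V (suc n)) (*-congˡ (+ k) (⟦⟧-mul-x+^ k a V n)) ⟩
    g (suc n ℕ.+ a ℕ.* p ℕ.^ k) + + k * g (n ℕ.+ a ℕ.* p ℕ.^ k)   ≡⟨ cong (λ i → g i + + k * g (n ℕ.+ a ℕ.* p ℕ.^ k)) (shift₁ n a (p ℕ.^ k)) ⟩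
    g (n ℕ.+ a ℕ.* p ℕ.^ k ℕ.+ 1) + + k * g (n ℕ.+ a ℕ.* p ℕ.^ k)  ≈⟨ TouchardStep-p^ k 1 g (⟦⟧-touchardStep V) (n ℕ.+ a ℕ.* p ℕ.^ k) ⟨
    g (n ℕ.+ a ℕ.* p ℕ.^ k ℕ.+ 1 ℕ.* p ℕ.^ k)                      ≡⟨ cong g (shift₂ n a (p ℕ.^ k)) ⟩
    g (n ℕ.+ suc a ℕ.* p ℕ.^ k)                                     ∎
    where
      open ≈-Reasoning
      W = mul-x+^ (+ k) a V
      g = ⟦ V ⟧ 𝐁
      shift₁ : ∀ n a x → suc n ℕ.+ a ℕ.* x ≡ n ℕ.+ a ℕ.* x ℕ.+ 1
      shift₁ = NatSolver.solve-∀
      shift₂ : ∀ n a x → n ℕ.+ a ℕ.* x ℕ.+ 1 ℕ.* x ≡ n ℕ.+ suc a ℕ.* x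
      shift₂ = NatSolver.solve-∀

  ⟦⟧-∏[x+e]^a : ∀ m (a e : Fin m → ℕ) n → ⟦ ∏[x+e]^a m a e ⟧ 𝐁 n ≈ 𝐁 (n ℕ.+ Σ[<] m (λ i → a i ℕ.* p ℕ.^ e i))
  ⟦⟧-∏[x+e]^a zero    a e n = ≈-reflexive (trans (unit (𝐁 n)) (cong 𝐁 (sym (ℕₚ.+-identityʳ n))))
    where unit : ∀ x → + 1 * x + + 0 ≡ x
          unit = solve-∀
  ⟦⟧-∏[x+e]^a (suc m) a e n = begin
    ⟦ mul-x+^ (+ e Fin.zero) (a Fin.zero) (∏[x+e]^a m (a ∘ Fin.suc) (e ∘ Fin.suc)) ⟧ 𝐁 n
      ≈⟨ ⟦⟧-mul-x+^ (e Fin.zero) (a Fin.zero) _ n ⟩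
    ⟦ ∏[x+e]^a m (a ∘ Fin.suc) (e ∘ Fin.suc) ⟧ 𝐁 (n ℕ.+ w Fin.zero)
      ≈⟨ ⟦⟧-∏[x+e]^a m (a ∘ Fin.suc) (e ∘ Fin.suc) (n ℕ.+ w Fin.zero) ⟩
    𝐁 (n ℕ.+ w Fin.zero ℕ.+ Σ[<] m (w ∘ Fin.suc))
      ≡⟨ cong 𝐁 (ℕₚ.+-assoc n (w Fin.zero) _) ⟩
    𝐁 (n ℕ.+ Σ[<] (suc m) w) ∎
    where
      open ≈-Reasoning
      w : Fin (suc m) → ℕ
      w i = a i ℕ.* p ℕ.^ e i

  p∤at1-∏[x+e]^a : ∀ m (a e : Fin m → ℕ) → (∀ i → suc (e i) < p) → ¬ (+ p ∣ at1 (∏[x+e]^a m a e))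
  p∤at1-∏[x+e]^a zero    a e _     = p∤small (s≤s z≤n) (s≤s (s≤s z≤n))
  p∤at1-∏[x+e]^a (suc m) a e e+1<p = powers (a Fin.zero) (p∤at1-∏[x+e]^a m (a ∘ Fin.suc) (e ∘ Fin.suc) (e+1<p ∘ Fin.suc))
    where
      powers : ∀ {d} c {V : Vec ℤ (suc d)} → ¬ (+ p ∣ at1 V) → ¬ (+ p ∣ at1 (mul-x+^ (+ e Fin.zero) c V))
      powers zero    p∤V = p∤V
      powers (suc c) p∤V = p∤-* (p∤small (s≤s z≤n) (e+1<p Fin.zero)) (powers c p∤V)
                           ∘ subst (+ p ∣_) (at1-mul-x+ (+ e Fin.zero) (mul-x+^ (+ e Fin.zero) c _))

  All≈0⇒at1≈0 : ∀ {k} {V : Vec ℤ k} → All (_≈ + 0) V → at1 V ≈ + 0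
  All≈0⇒at1≈0 []           = ≈-refl
  All≈0⇒at1≈0 (c≈0 ∷ cs≈0) = +-cong c≈0 (All≈0⇒at1≈0 cs≈0)

  x^p-x-1-annihilates : Annihilates (x^[2+k]-x-1 q)
  x^p-x-1-annihilates n = begin
    ⟦ x^[2+k]-x-1 q ⟧ 𝐁 n                         ≡⟨ ⟦⟧-x^[2+k]-x-1 q 𝐁 n ⟩
    𝐁 (n ℕ.+ p) - 𝐁 (suc n) - 𝐁 n                 ≈⟨ sub-cong (sub-cong (touchard n) (≈-refl {𝐁 (suc n)})) (≈-refl {𝐁 n}) ⟩
    𝐁 (suc n) + 𝐁 n - 𝐁 (suc n) - 𝐁 n             ≡⟨ vanish (𝐁 (suc n)) (𝐁 n) ⟩
    + 0                                           ∎
    where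
      open ≈-Reasoning
      vanish : ∀ a b → a + b - a - b ≡ + 0
      vanish = solve-∀

  period⇒annihilates : ∀ {d} (Q : Vec ℤ (suc d)) → (∀ n → ⟦ Q ⟧ 𝐁 n ≈ 𝐁 n) → Annihilates (Q ⊖ const d (+ 1))
  period⇒annihilates {d} Q period n = begin
    ⟦ Q ⊖ const d (+ 1) ⟧ 𝐁 n                     ≡⟨ ⟦⟧-⊖ Q (const d (+ 1)) 𝐁 n ⟩
    ⟦ Q ⟧ 𝐁 n - ⟦ const d (+ 1) ⟧ 𝐁 n             ≡⟨ cong (_-_ (⟦ Q ⟧ 𝐁 n)) (trans (⟦⟧-const d (+ 1) 𝐁 n) (ℤₚ.*-identityˡ (𝐁 n))) ⟩
    ⟦ Q ⟧ 𝐁 n - 𝐁 n                               ≈⟨ sub-cong (period n) ≈-refl ⟩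
    𝐁 n - 𝐁 n                                     ≡⟨ ℤₚ.+-inverseʳ (𝐁 n) ⟩
    + 0                                           ∎
    where open ≈-Reasoning

  p∣at1-of-monic-period : ∀ {d} (Q : Vec ℤ (suc d)) → 1 ≤ d → d ≤ p → lead Q ≡ + 1 →
                          (∀ n → ⟦ Q ⟧ 𝐁 n ≈ 𝐁 n) → + p ∣ at1 Q
  p∣at1-of-monic-period {suc d} Q _ d≤p lead≡1 period with ℕₚ.m≤n⇒m<n∨m≡n d≤p
  ... | inj₁ d<p  = ⊥-elim (1≉0 (≈-trans (≈-reflexive (sym lead≡1-0)) (lead-annihilator≈0 d<p (Q ⊖ one) (period⇒annihilates Q period))))
    where
      one = const (suc d) (+ 1)
      lead≡1-0 : lead (Q ⊖ one) ≡ + 1 - + 0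
      lead≡1-0 = trans (lead-⊖ Q one) (cong₂ _-_ lead≡1 (lead-const d (+ 1)))
  ... | inj₂ refl = ≈0⇒∣ (≈-trans (≈-reflexive (sym at1≡)) (All≈0⇒at1≈0 (annihilator-of-degree-p≈0 V ann lead≈0)))
    where
      one = const p (+ 1)
      V = Q ⊖ one ⊖ x^[2+k]-x-1 q
      ann : Annihilates V
      ann n = ≈-trans (≈-reflexive (⟦⟧-⊖ (Q ⊖ one) (x^[2+k]-x-1 q) 𝐁 n))
                      (sub-cong (period⇒annihilates Q period n) (x^p-x-1-annihilates n))
      lead≈0 : lead V ≈ + 0
      lead≈0 = ≈-reflexive (begin
        lead V                                  ≡⟨ lead-⊖ (Q ⊖ one) (x^[2+k]-x-1 q) ⟩
        lead (Q ⊖ one) - lead (x^[2+k]-x-1 q)   ≡⟨ cong₂ _-_ (lead-⊖ Q one) (lead-x^[2+k]-x-1 q) ⟩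
        (lead Q - lead one) - + 1               ≡⟨ cong₂ (λ a b → (a - b) - + 1) lead≡1 (lead-const (suc q) (+ 1)) ⟩
        + 0                                     ∎)
        where open ≡-Reasoning
      at1≡ : at1 V ≡ at1 Q
      at1≡ = begin
        at1 V                                   ≡⟨ at1-⊖ (Q ⊖ one) (x^[2+k]-x-1 q) ⟩
        at1 (Q ⊖ one) - at1 (x^[2+k]-x-1 q)     ≡⟨ cong₂ _-_ (trans (at1-⊖ Q one) (cong (_-_ (at1 Q)) (at1-const p (+ 1)))) (at1-x^[2+k]-x-1 q) ⟩
        (at1 Q - + 1) - - + 1                   ≡⟨ simplify (at1 Q) ⟩
        at1 Q                                   ∎
        where
          open ≡-Reasoning
          simplify : ∀ a → (a - + 1) - - + 1 ≡ a
          simplify = solve-∀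

  0<Σ[<]a*w⇒0<Σ[<]a : ∀ m (a w : Fin m → ℕ) → 0 < Σ[<] m (λ i → a i ℕ.* w i) → 0 < Σ[<] m a
  0<Σ[<]a*w⇒0<Σ[<]a (suc m) a w pos with a Fin.zero
  ... | suc _ = s≤s z≤n
  ... | zero  = 0<Σ[<]a*w⇒0<Σ[<]a m (a ∘ Fin.suc) (w ∘ Fin.suc) pos

  digit-sum-of-period : (a : Fin (suc q) → ℕ) → 0 < digitValue p (suc q) a →
                        (∀ n → B (n ℕ.+ digitValue p (suc q) a) % p ≡ B n % p) → p ℕ.+ 1 ≤ Σ[<] (suc q) a
  digit-sum-of-period a P>0 period with p ℕ.+ 1 ℕₚ.≤? Σ[<] (suc q) a
  ... | yes p+1≤s = p+1≤s
  ... | no  p+1≰s = ⊥-elim (p∤at1-∏[x+e]^a (suc q) a Fin.toℕ (λ i → s≤s (toℕ<n i))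
                             (p∣at1-of-monic-period Q 1≤s s≤p (lead-∏[x+e]^a (suc q) a Fin.toℕ) Q-period))
    where
      s = Σ[<] (suc q) a
      Q = ∏[x+e]^a (suc q) a Fin.toℕ
      s≤p : s ≤ p
      s≤p = ℕₚ.m<1+n⇒m≤n (subst (s <_) (ℕₚ.+-comm p 1) (ℕₚ.≰⇒> p+1≰s))
      1≤s : 1 ≤ s
      1≤s = 0<Σ[<]a*w⇒0<Σ[<]a (suc q) a (λ i → p ℕ.^ Fin.toℕ i) P>0
      Q-period : ∀ n → ⟦ Q ⟧ 𝐁 n ≈ 𝐁 n
      Q-period n = ≈-trans (⟦⟧-∏[x+e]^a (suc q) a Fin.toℕ n) (%-≡⇒≈ _ _ (period n))

open BellModPrime using (digit-sum-of-period)
open import Data.Nat using (_+_)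

theorem3 : (p : ℕ) → (pp : Prime p) → .{{_ : NonZero p}} → (a : Fin (p ∸ 1) → ℕ) →
    (∀ k → a k < p) →
    0 < digitValue p (p ∸ 1) a →
    (∀ n → B (n + digitValue p (p ∸ 1) a) % p ≡ B n % p) →
    p + 1 ≤ Σ[<] (p ∸ 1) a
theorem3 zero          pp _ _ _ _ = ⊥-elim (¬prime[0] pp)
theorem3 (suc zero)    pp _ _ _ _ = ⊥-elim (¬prime[1] pp)
theorem3 (suc (suc q)) pp a _     = digit-sum-of-period q pp a
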